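{- Consider the relaxed (non-elementary) setting described in the context. Let $L$ be a label such that $\eta(L)=1$. Then for every $j\in N(L)$, the label $L'=L\oplus j$ is dominated by $L$, i.e. $$p(L) + \Delta^-(L, L') - \Delta^+(L', L) \geq p(L').$$
   Context: Setting (pricing subproblem for ranked-list choice models). Let $\mathcal{N}=\{1,\ldots,n\}$ be a set of products and $\mathcal{T}$ a finite set of transactions. Each $t\in\mathcal{T}$ has an offer set $\emptyset\ne S_t\subseteq\mathcal{N}$, a bundle $B_t\subseteq S_t$ (possibly empty), and a real reward $\mu_t\neq 0$. Write $R_t=S_t\setminus B_t$, $\mathcal{T}_+=\{t:\mu_t>0\}$, $\mathcal{T}_-=\{t:\mu_t<0\}$. Labels. A label $L$ records a set $N(L)\subseteq\mathcal{N}$, an integer $\eta(L)\in\{1,\ldots,n\}$, a real profit $p(L)$, and integers $\kappa_t(L)\in\{ -1,0,1,\ldots\}$ for $t\in\mathcal{T}$. Initial labels $L_0^\eta$ ($\eta=1,\ldots,n$): $N=\emptyset$, $\eta(L_0^\eta)=\eta$, $p(L_0^\eta)=\sum_{t:B_t=\emptyset}\mu_t$, $\kappa_t(L_0^\eta)=0$ if $|B_t|\le\eta$ and $-1$ otherwise. Labels are those obtained from an initial label by finitely many extensions. Relaxed extension $L'=L\oplus j$, for any $j\in\mathcal{N}$ (including $j\in N(L)$): $N(L')=N(L)\cup\{j\}$, $\eta(L')=\eta(L)$; start with $\kappa_t(L')=\kappa_t(L)$, $p(L')=p(L)$; for each $t$ with $\kappa_t(L)\ge0$: if $j\in R_t$,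 subtract $\mu_t$ from $p(L')$ in case $\kappa_t(L)\ge|B_t|$, and set $\kappa_t(L')=-1$; else if $j\in B_t$, set $\kappa_t(L')=\kappa_t(L)+1$, add $\mu_t$ to $p(L')$ if $\kappa_t(L')=|B_t|$, and then set $\kappa_t(L')=-1$ if $\kappa_t(L')=\eta(L)$. Dominance quantities. For labels $L,L'$ and $s\in\{+,-\}$: $\mathcal{T}^2_s(L,L')=\{t\in\mathcal{T}_s: 0\le\kappa_t(L)<|B_t|,\ \kappa_t(L')\ge|B_t|,\ \eta(L')-\kappa_t(L')+\kappa_t(L)>|B_t|\}$; $\mathcal{T}^{1a}_s(L,L')=\{t\in\mathcal{T}_s\setminus\mathcal{T}^2_s(L,L'): 0\le\kappa_t(L)<|B_t|$ and ($\kappa_t(L')=-1$ or $\kappa_t(L')\ge|B_t|$)$\}$; $\mathcal{T}^{1b}_s(L,L')=\{t\in\mathcal{T}_s\setminus\mathcal{T}^2_s(L,L'): \kappa_t(L')\ge|B_t|,\ \kappa_t(L)<|B_t|\}$; $\mathcal{T}^1_s=\mathcal{T}^{1a}_s\cup\mathcal{T}^{1b}_s$; $\Delta^s(L,L')=2\sum_{t\in\mathcal{T}^2_s(L,L')}\mu_t+\sum_{t\in\mathcal{T}^1_s(L,L')}\mu_t$. In the relaxed setting, a label $L$ dominates $L'$ if the displayed inequality holds.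
   Formalization: The rewards $\mu_t$ and the profits $p(L)$ are rational rather than real. -}

module Defs where

open import Data.Nat as ℕ using (ℕ; zero; suc)
open import Data.Integer as ℤ using (ℤ; +_; -[1+_]; _≤ᵇ_)
open import Data.Integer.Properties as ℤP using ()
open import Data.Rational as ℚ using (ℚ; 0ℚ)
open import Data.Rational.Properties as ℚP using ()
open import Data.Bool using (Bool; true; false; if_then_else_; _∧_; _∨_; not)
open import Data.Fin using (Fin; zero; suc)
open import Data.Fin.Subset using (Subset; _⊆_; Nonempty; ∣_∣)
open import Data.Vec using (lookup)
open import Data.Product using (_×_; _,_; proj₁; proj₂)
open import Relation.Nullary using (does; ¬_)
open import Relation.Binary.PropositionalEquality using (_≡_)

-- A problem instance: products are Fin n, transactions are Fin m.
-- Rewards are taken in ℚ (no reals in agda-stdlib).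
record Instance (n m : ℕ) : Set where
  field
    S     : Fin m → Subset n
    B     : Fin m → Subset n
    μ     : Fin m → ℚ
    S-ne  : ∀ t → Nonempty (S t)
    B⊆S   : ∀ t → B t ⊆ S t
    μ≢0   : ∀ t → ¬ (μ t ≡ 0ℚ)

record Label (n m : ℕ) : Set where
  constructor label
  field
    N : Subset n
    η : ℕ
    p : ℚ
    κ : Fin m → ℤ
open Label public

sumFin : ∀ {m} → (Fin m → ℚ) → ℚ
sumFin {zero}  f = 0ℚ
sumFin {suc m} f = f zero ℚ.+ sumFin (λ i → f (suc i))

_≟ᵇ_ : ℤ → ℤ → Bool
a ≟ᵇ b = does (a ℤP.≟ b)

_<ᵇ_ : ℤ → ℤ → Bool
a <ᵇ b = does (a ℤP.<? b)

-1ℤ : ℤ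
-1ℤ = -[1+ 0 ]

module _ {n m : ℕ} (I : Instance n m) where
  open Instance I

  bsz : Fin m → ℤ
  bsz t = + ∣ B t ∣

  inS inB inR : Fin m → Fin n → Bool
  inS t j = lookup (S t) j
  inB t j = lookup (B t) j
  inR t j = inS t j ∧ not (inB t j)

  initial : ℕ → Label n m
  initial e = label (Data.Vec.replicate n false)
                    e
                    (sumFin (λ t → if ∣ B t ∣ ℕ.≡ᵇ 0 then μ t else 0ℚ))
                    (λ t → if ∣ B t ∣ ℕ.≤ᵇ e then + 0 else -1ℤ)

  -- per-transaction effect of the relaxed extension by j:
  -- returns (κ_t(L'), change of profit contributed by t)
  step : (e : ℕ) → Fin m → Fin n → ℤ → ℤ × ℚ
  step e t j k =
    if not (+ 0 ≤ᵇ k) then (k , 0ℚ)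
    else if inR t j then (-1ℤ , (if bsz t ≤ᵇ k then ℚ.- μ t else 0ℚ))
    else if inB t j then
      ((if (k ℤ.+ + 1) ≟ᵇ (+ e) then -1ℤ else (k ℤ.+ + 1)) ,
       (if (k ℤ.+ + 1) ≟ᵇ bsz t then μ t else 0ℚ))
    else (k , 0ℚ)

  -- relaxed extension L ⊕ j (j may already lie in N(L))
  _⊕_ : Label n m → Fin n → Label n m
  L ⊕ j = label (N L Data.Vec.[ j ]≔ true)
                (η L)
                (p L ℚ.+ sumFin (λ t → proj₂ (step (η L) t j (κ L t))))
                (λ t → proj₁ (step (η L) t j (κ L t)))

  data IsLabel : Label n m → Set where
    init : ∀ e → 1 ℕ.≤ e → e ℕ.≤ n → IsLabel (initial e)
    ext  : ∀ {L} → IsLabel L → (j : Fin n) → IsLabel (L ⊕ j)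

  -- sign s : true = '+', false = '-'
  hasSign : Bool → ℚ → Bool
  hasSign true  x = does (0ℚ ℚP.<? x)
  hasSign false x = does (x ℚP.<? 0ℚ)

  -- membership of t in T²_s(L,L'), T^{1a}_s(L,L'), T^{1b}_s(L,L') (sign handled separately)
  inT2 : Label n m → Label n m → Fin m → Bool
  inT2 L L' t = (+ 0 ≤ᵇ κ L t) ∧ (κ L t <ᵇ bsz t) ∧ (bsz t ≤ᵇ κ L' t)
                ∧ (bsz t <ᵇ ((+ η L' ℤ.- κ L' t) ℤ.+ κ L t))

  inT1a : Label n m → Label n m → Fin m → Bool
  inT1a L L' t = not (inT2 L L' t) ∧ (+ 0 ≤ᵇ κ L t) ∧ (κ L t <ᵇ bsz t)
                 ∧ ((κ L' t ≟ᵇ -1ℤ) ∨ (bsz t ≤ᵇ κ L' t))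

  inT1b : Label n m → Label n m → Fin m → Bool
  inT1b L L' t = not (inT2 L L' t) ∧ (bsz t ≤ᵇ κ L' t) ∧ (κ L t <ᵇ bsz t)

  Δ : Bool → Label n m → Label n m → ℚ
  Δ s L L' = sumFin (λ t →
    if hasSign s (μ t) then
      (if inT2 L L' t then μ t ℚ.+ μ t
       else if inT1a L L' t ∨ inT1b L L' t then μ t else 0ℚ)
    else 0ℚ)

{-# OPTIONS --safe #-}
-- With η = 1 every counter κ_t stays in {0, −1}, and t is closed (κ_t = −1) as
-- soon as N(L) meets S_t: a product of R_t closes t, and one of B_t raises κ_t
-- to η.  Re-adding j ∈ N(L) therefore touches no open transaction, so L ⊕ j has
-- the same profit and counters as L.  Finally Δ^s(L, L′) vanishes whenever L and
-- L′ have the same counters: membership in T², T^{1a} or T^{1b} needs κ_t to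
-- cross |B_t| or to drop from ≥ 0 to −1.  The inequality thus holds with equality.
module Submission where

open import Defs
open import Data.Nat using (ℕ)
import Data.Nat as ℕ
open import Data.Fin using (Fin)
open import Data.Fin.Properties using (_≟_)
open import Data.Fin.Subset using (_∈_; ∣_∣)
open import Data.Bool using (Bool; true; false; T; not; _∧_; _∨_; if_then_else_)
open import Data.Bool.Properties using (T-∧; T-∨; ¬-not)
open import Data.Empty using (⊥-elim)
open import Data.Integer using (+_; -[1+_]; NonPositive; Negative; _≤ᵇ_)
import Data.Integer.Properties as ℤ
open import Data.Product using (_×_; _,_; proj₁; proj₂)
open import Data.Rational using (ℚ; 0ℚ; _≤_; _+_; _-_)
import Data.Rational.Properties as ℚ
open import Data.Sum using (_⊎_; inj₁; inj₂; [_,_]′)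
open import Data.Vec using (lookup)
open import Data.Vec.Properties using (lookup∘update′; lookup-replicate; []=⇒lookup; lookup⇒[]=)
open import Function using (Equivalence; _∘_)
open import Relation.Binary.PropositionalEquality
  using (_≡_; refl; sym; trans; cong; cong₂; subst; module ≡-Reasoning)
open import Relation.Nullary using (¬_; yes; no; contradiction)

sumFin-zero : ∀ {k} (f : Fin k → ℚ) → (∀ t → f t ≡ 0ℚ) → sumFin f ≡ 0ℚ
sumFin-zero {ℕ.zero}  f f≡0 = refl
sumFin-zero {ℕ.suc k} f f≡0
  rewrite f≡0 Fin.zero | sumFin-zero (λ t → f (Fin.suc t)) (λ t → f≡0 (Fin.suc t)) = refl

<ᵇ⇒≱ᵇ : ∀ i j → T (i <ᵇ j) → ¬ T (j ≤ᵇ i)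
<ᵇ⇒≱ᵇ i j i<ᵇj j≤ᵇi with i ℤ.<? j
<ᵇ⇒≱ᵇ _ _ _  j≤ᵇi | yes i<j = ℤ.<⇒≱ i<j (ℤ.≤ᵇ⇒≤ j≤ᵇi)
<ᵇ⇒≱ᵇ _ _ () _    | no _

≥ᵇ0⇒≢ᵇ-1 : ∀ i → T (+ 0 ≤ᵇ i) → ¬ T (i ≟ᵇ -1ℤ)
≥ᵇ0⇒≢ᵇ-1 (+ _) _ ()

∧⁻ : ∀ x {y} → T (x ∧ y) → T x × T y
∧⁻ _ = Equivalence.to T-∧

∨⁻ : ∀ x {y} → T (x ∨ y) → T x ⊎ T y
∨⁻ _ = Equivalence.to T-∨

if-if-zero : ∀ s x y (μ : ℚ) → ¬ T x → ¬ T y →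
  (if s then (if x then μ + μ else if y then μ else 0ℚ) else 0ℚ) ≡ 0ℚ
if-if-zero false _     _     _ _  _  = refl
if-if-zero true  false false _ _  _  = refl
if-if-zero true  true  _     _ ¬x _  = ⊥-elim (¬x _)
if-if-zero true  false true  _ _  ¬y = ⊥-elim (¬y _)

module _ {n m : ℕ} (I : Instance n m) where
  open Instance I

  module _ {L L′ : Label n m} {t : Fin m} (κ≡ : κ L′ t ≡ κ L t) where

    private
      crossed : T (κ L t <ᵇ bsz I t) → ¬ T (bsz I t ≤ᵇ κ L′ t)
      crossed k<c = <ᵇ⇒≱ᵇ (κ L t) (bsz I t) k<c ∘ subst (λ k → T (bsz I t ≤ᵇ k)) κ≡

    ∉T² : ¬ T (inT2 I L L′ t)
    ∉T² h =
      let _    , r  = ∧⁻ (+ 0 ≤ᵇ κ L t) h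
          k<c  , r′ = ∧⁻ (κ L t <ᵇ bsz I t) r
          c≤k′ , _  = ∧⁻ (bsz I t ≤ᵇ κ L′ t) r′
      in crossed k<c c≤k′

    ∉T¹ᵃ : ¬ T (inT1a I L L′ t)
    ∉T¹ᵃ h
      with _ , r ← ∧⁻ (not (inT2 I L L′ t)) h
      with 0≤k , r′ ← ∧⁻ (+ 0 ≤ᵇ κ L t) r
      with k<c , r″ ← ∧⁻ (κ L t <ᵇ bsz I t) r′
      with ∨⁻ (κ L′ t ≟ᵇ -1ℤ) r″
    ... | inj₁ k′≡-1 = ≥ᵇ0⇒≢ᵇ-1 (κ L t) 0≤k (subst (λ k → T (k ≟ᵇ -1ℤ)) κ≡ k′≡-1)
    ... | inj₂ c≤k′  = crossed k<c c≤k′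

    ∉T¹ᵇ : ¬ T (inT1b I L L′ t)
    ∉T¹ᵇ h =
      let _    , r   = ∧⁻ (not (inT2 I L L′ t)) h
          c≤k′ , k<c = ∧⁻ (bsz I t ≤ᵇ κ L′ t) r
      in crossed k<c c≤k′

    ∉T¹ : ¬ T (inT1a I L L′ t ∨ inT1b I L L′ t)
    ∉T¹ = [ ∉T¹ᵃ , ∉T¹ᵇ ]′ ∘ ∨⁻ (inT1a I L L′ t)

  κ-stable⇒Δ≡0 : ∀ s {L L′} → (∀ t → κ L′ t ≡ κ L t) → Δ I s L L′ ≡ 0ℚ
  κ-stable⇒Δ≡0 s {L} {L′} κ≡ = sumFin-zero _ λ t →
    if-if-zero (hasSign I s (μ t)) (inT2 I L L′ t) (inT1a I L L′ t ∨ inT1b I L L′ t) (μ t)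
      (∉T² {L} {L′} (κ≡ t)) (∉T¹ {L} {L′} (κ≡ t))

  inB⇒inS : ∀ t j → inB I t j ≡ true → inS I t j ≡ true
  inB⇒inS t j = []=⇒lookup ∘ B⊆S t ∘ lookup⇒[]= j (B t)

  ¬inS⇒¬inB : ∀ t j → inS I t j ≡ false → inB I t j ≡ false
  ¬inS⇒¬inB t j j∉S = ¬-not λ j∈B → contradiction (trans (sym (inB⇒inS t j j∈B)) j∉S) λ ()

  step-negative : ∀ e t j {k} → Negative k → step I e t j k ≡ (k , 0ℚ)
  step-negative e t j { -[1+ _ ]} _ = refl

  step-outside : ∀ e t j k → inS I t j ≡ false → step I e t j k ≡ (k , 0ℚ)
  step-outside e t j k j∉S with + 0 ≤ᵇ k
  ... | false = refl
  ... | true rewrite j∉S | ¬inS⇒¬inB t j j∉S = refl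

  step₁-nonPositive : ∀ t j {k} → NonPositive k → NonPositive (proj₁ (step I 1 t j k))
  step₁-nonPositive t j { -[1+ _ ]} _ = _
  step₁-nonPositive t j {+ 0} _ with inS I t j | inB I t j
  ... | true  | true  = _
  ... | true  | false = _
  ... | false | true  = _
  ... | false | false = _

  step₁-offered : ∀ t j {k} → NonPositive k → inS I t j ≡ true →
                  Negative (proj₁ (step I 1 t j k))
  step₁-offered t j { -[1+ _ ]} _ _ = _
  step₁-offered t j {+ 0} _ j∈S with inS I t j | inB I t j
  ... | true  | true  = _
  ... | true  | false = _

  record Settled (L : Label n m) : Set where
    field
      κ-nonPositive : ∀ t → NonPositive (κ L t)
      κ-negative    : ∀ {j} t → lookup (N L) j ≡ true → inS I t j ≡ true → Negative (κ L t)

  initial-settled : Settled (initial I 1)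
  initial-settled = record { κ-nonPositive = κ-nonPositive ; κ-negative = κ-negative }
    where
    κ-nonPositive : ∀ t → NonPositive (κ (initial I 1) t)
    κ-nonPositive t with ∣ B t ∣ ℕ.≤ᵇ 1
    ... | true  = _
    ... | false = _
    κ-negative : ∀ {j} t → lookup (N (initial I 1)) j ≡ true → inS I t j ≡ true →
                 Negative (κ (initial I 1) t)
    κ-negative {j} _ j∈N _ = contradiction (trans (sym (lookup-replicate j false)) j∈N) λ ()

  ⊕-settled : ∀ {L} → η L ≡ 1 → Settled L → ∀ j′ → Settled (_⊕_ I L j′)
  -- Matching L against its constructor lets η L ≡ 1 be matched by refl, so step runs at η = 1.
  ⊕-settled {L@(label _ _ _ _)} refl settled j′ =
    record { κ-nonPositive = κ-nonPositive ; κ-negative = κ-negative }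
    where
    open Settled settled renaming (κ-nonPositive to κ≤0; κ-negative to κ<0)
    κ-nonPositive : ∀ t → NonPositive (κ (_⊕_ I L j′) t)
    κ-nonPositive t = step₁-nonPositive t j′ (κ≤0 t)
    κ-negative : ∀ {j} t → lookup (N (_⊕_ I L j′)) j ≡ true → inS I t j ≡ true →
                 Negative (κ (_⊕_ I L j′) t)
    κ-negative {j} t j∈N′ j∈S with j ≟ j′
    ... | yes refl = step₁-offered t j (κ≤0 t) j∈S
    ... | no j≢j′  = subst Negative (sym (cong proj₁ (step-negative 1 t j′ k<0))) k<0
      where
      k<0 : Negative (κ L t)
      k<0 = κ<0 t (trans (sym (lookup∘update′ j≢j′ (N L) true)) j∈N′) j∈S

  settled : ∀ {L} → IsLabel I L → η L ≡ 1 → Settled L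
  settled (init _ _ _) refl = initial-settled
  settled (ext isL j′) η≡1 = ⊕-settled η≡1 (settled isL η≡1) j′

  settled⇒step-idle : ∀ {L j} → Settled L → lookup (N L) j ≡ true →
                      ∀ t → step I (η L) t j (κ L t) ≡ (κ L t , 0ℚ)
  settled⇒step-idle {L} {j} settled j∈N t = by-offer (inS I t j) refl
    where
    by-offer : ∀ b → inS I t j ≡ b → step I (η L) t j (κ L t) ≡ (κ L t , 0ℚ)
    by-offer true  j∈S = step-negative (η L) t j (Settled.κ-negative settled t j∈N j∈S)
    by-offer false j∉S = step-outside (η L) t j (κ L t) j∉S

  ⊕-preserves-p : ∀ {L j} → Settled L → lookup (N L) j ≡ true → p (_⊕_ I L j) ≡ p L
  ⊕-preserves-p {L} {j} settled j∈N = begin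
    p L + sumFin (λ t → proj₂ (step I (η L) t j (κ L t)))
      ≡⟨ cong (λ x → p L + x) (sumFin-zero _ (cong proj₂ ∘ settled⇒step-idle settled j∈N)) ⟩
    p L + 0ℚ
      ≡⟨ ℚ.+-identityʳ (p L) ⟩
    p L
      ∎
    where open ≡-Reasoning

  ⊕-preserves-κ : ∀ {L j} → Settled L → lookup (N L) j ≡ true →
                  ∀ t → κ (_⊕_ I L j) t ≡ κ L t
  ⊕-preserves-κ settled j∈N = cong proj₁ ∘ settled⇒step-idle settled j∈N

proposition3 : ∀ {n m : ℕ} (I : Instance n m) (L : Label n m) → IsLabel I L →
    η L ≡ 1 → (j : Fin n) → j ∈ N L →
    p (_⊕_ I L j) ≤ (p L + Δ I false L (_⊕_ I L j)) - Δ I true (_⊕_ I L j) L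
proposition3 I L isL η≡1 j j∈N = ℚ.≤-reflexive (begin
  p L′                                  ≡⟨ ⊕-preserves-p I S j∈N′ ⟩
  p L                                   ≡⟨ sym (ℚ.+-identityʳ _) ⟩
  p L + 0ℚ                              ≡⟨ sym (ℚ.+-identityʳ _) ⟩
  p L + 0ℚ - 0ℚ                         ≡⟨ cong₂ (λ x y → p L + x - y) (sym Δ⁻≡0) (sym Δ⁺≡0) ⟩
  p L + Δ I false L L′ - Δ I true L′ L  ∎)
  where
  open ≡-Reasoning
  L′ : Label _ _
  L′ = _⊕_ I L j
  S : Settled I L
  S = settled I isL η≡1
  j∈N′ : lookup (N L) j ≡ true
  j∈N′ = []=⇒lookup j∈N
  Δ⁻≡0 : Δ I false L L′ ≡ 0ℚ
  Δ⁻≡0 = κ-stable⇒Δ≡0 I false {L} {L′} (⊕-preserves-κ I S j∈N′)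
  Δ⁺≡0 : Δ I true L′ L ≡ 0ℚ
  Δ⁺≡0 = κ-stable⇒Δ≡0 I true {L′} {L} (sym ∘ ⊕-preserves-κ I S j∈N′)
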